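{- If $\mathbb{C}$ is a complete m-algebra (resp. complete c-algebra), then $\mathbb{C}^\bullet$ is a complete supported heterogeneous m-algebra (resp. a complete heterogeneous c-algebra).
   Context: An m-algebra is $(\mathbb{A},\nabla)$ with $\mathbb{A}$ a Boolean algebra and $\nabla$ monotone unary; it is complete if $\mathbb{A}$ is a complete Boolean algebra. A c-algebra is $(\mathbb{A},>)$ with $>$ binary and finitely meet-preserving in its second coordinate; it is complete if $\mathbb{A}$ is complete and $>$ preserves arbitrary meets in its second coordinate. For a complete m-algebra $\mathbb{C}=(\mathbb{A},\nabla)$, $\mathbb{C}^\bullet=(\mathbb{A},\mathcal{P}(\mathbb{A}),[\ni],\langle\not\ni\rangle,\langle\nu\rangle,[\nu^c])$ with, for $a\in\mathbb{A}$ and $B\subseteq\mathbb{A}$: $[\ni]a=\{b\in\mathbb{A}\mid b\le a\}$, $\langle\not\ni\rangle a=\{b\in\mathbb{A}\mid a\not\le b\}$, $\langle\nu\rangle B=\bigvee\{\nabla b\mid b\in B\}$, $[\nu^c]B=\bigwedge\{\nabla b\mid b\notin B\}$. For a complete c-algebra $\mathbb{C}=(\mathbb{A},>)$, $\mathbb{C}^\bullet=(\mathbb{A},\mathcal{P}(\mathbb{A}),[\ni],[\not\ni\rangle,\rhd)$ with $[\ni]a$ as before, $[\not\ni\rangle a=\{b\in\mathbb{A}\mid a\le b\}$ and $B\rhd a=\bigwedge\{b>a\mid b\in B\}$. A heterogeneous m-algebra is $(\mathbb{A},\mathbb{B},[\ni],\langle\not\ni\rangle,\langle\nu\rangle,[\nu^c])$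 with $\mathbb{A},\mathbb{B}$ Boolean algebras, $\langle\nu\rangle,[\nu^c]:\mathbb{B}\to\mathbb{A}$ finitely join-preserving, resp. finitely meet-preserving, $[\ni],\langle\not\ni\rangle:\mathbb{A}\to\mathbb{B}$ finitely meet-preserving, resp. finitely join-preserving; it is supported if $\langle\nu\rangle[\ni]a=[\nu^c]\langle\not\ni\rangle a$ for all $a$. A heterogeneous c-algebra is $(\mathbb{A},\mathbb{B},[\ni],[\not\ni\rangle,\rhd)$ with $\mathbb{A},\mathbb{B}$ Boolean algebras, $[\ni]:\mathbb{A}\to\mathbb{B}$ finitely meet-preserving, $[\not\ni\rangle:\mathbb{A}\to\mathbb{B}$ finitely join-reversing (sends finite joins to meets), and $\rhd:\mathbb{B}\times\mathbb{A}\to\mathbb{A}$ finitely join-reversing in the first and finitely meet-preserving in the second coordinate. Such a heterogeneous algebra is complete if $\mathbb{A},\mathbb{B}$ are complete and all these preservation/reversal properties hold for arbitrary joins and meets. -}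

module Defs where

open import Level using (Level; suc; _⊔_)
open import Data.Bool using (Bool; true; false)
import Data.Bool as 𝔹
import Data.Bool.Properties as 𝔹P
open import Data.Product using (Σ; _×_; _,_; proj₁; proj₂)
open import Relation.Nullary using (Dec; does; yes; no; ¬_)
open import Relation.Binary.PropositionalEquality
  using (_≡_; refl; sym; trans; cong; cong₂)
open import Algebra.Lattice.Bundles using (BooleanAlgebra)
open import Algebra.Lattice.Structures using (IsBooleanAlgebra)
import Relation.Binary.Reasoning.Setoid as SetoidReasoning

-- Classical metatheory: the paper works in ordinary (classical) set theory.

LEM : (ℓ : Level) → Set (suc ℓ)
LEM ℓ = (P : Set ℓ) → Dec P

module _ {ℓ : Level} (𝔸 : BooleanAlgebra ℓ ℓ) where
  open BooleanAlgebra 𝔸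

  Leq : Carrier → Carrier → Set ℓ
  Leq x y = (x ∧ y) ≈ x

  IsLub : {I : Set ℓ} → (I → Carrier) → Carrier → Set (ℓ)
  IsLub f x = (∀ i → Leq (f i) x) × (∀ y → (∀ i → Leq (f i) y) → Leq x y)

  IsGlb : {I : Set ℓ} → (I → Carrier) → Carrier → Set (ℓ)
  IsGlb f x = (∀ i → Leq x (f i)) × (∀ y → (∀ i → Leq y (f i)) → Leq y x)

  -- A complete Boolean algebra: every family indexed by a set of the
  -- ambient universe (in particular every subset of the carrier) has a
  -- join and a meet.
  record Complete : Set (suc ℓ) where
    field
      ⋁     : {I : Set ℓ} → (I → Carrier) → Carrier
      ⋁-lub : {I : Set ℓ} (f : I → Carrier) → IsLub f (⋁ f)
      ⋀     : {I : Set ℓ} → (I → Carrier) → Carrier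
      ⋀-glb : {I : Set ℓ} (f : I → Carrier) → IsGlb f (⋀ f)

module _ {ℓ : Level} (𝔸 𝔹 : BooleanAlgebra ℓ ℓ) where
  private
    module A = BooleanAlgebra 𝔸
    module B = BooleanAlgebra 𝔹

  Cong : (A.Carrier → B.Carrier) → Set ℓ
  Cong h = ∀ {x y} → x A.≈ y → h x B.≈ h y

  FinJoinPres : (A.Carrier → B.Carrier) → Set ℓ
  FinJoinPres h = Cong h × (h A.⊥ B.≈ B.⊥) × (∀ x y → h (x A.∨ y) B.≈ (h x B.∨ h y))

  FinMeetPres : (A.Carrier → B.Carrier) → Set ℓ
  FinMeetPres h = Cong h × (h A.⊤ B.≈ B.⊤) × (∀ x y → h (x A.∧ y) B.≈ (h x B.∧ h y))

  FinJoinRev : (A.Carrier → B.Carrier) → Set ℓ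
  FinJoinRev h = Cong h × (h A.⊥ B.≈ B.⊤) × (∀ x y → h (x A.∨ y) B.≈ (h x B.∧ h y))

  JoinPres : (A.Carrier → B.Carrier) → Set (suc ℓ)
  JoinPres h = ∀ {I : Set ℓ} (f : I → A.Carrier) x →
               IsLub 𝔸 f x → IsLub 𝔹 (λ i → h (f i)) (h x)

  MeetPres : (A.Carrier → B.Carrier) → Set (suc ℓ)
  MeetPres h = ∀ {I : Set ℓ} (f : I → A.Carrier) x →
               IsGlb 𝔸 f x → IsGlb 𝔹 (λ i → h (f i)) (h x)

  JoinRev : (A.Carrier → B.Carrier) → Set (suc ℓ)
  JoinRev h = ∀ {I : Set ℓ} (f : I → A.Carrier) x →
              IsLub 𝔸 f x → IsGlb 𝔹 (λ i → h (f i)) (h x)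

record MAlg (ℓ : Level) : Set (suc ℓ) where
  field
    𝔸      : BooleanAlgebra ℓ ℓ
  open BooleanAlgebra 𝔸
  field
    ∇      : Carrier → Carrier
    ∇-mono : ∀ {x y} → Leq 𝔸 x y → Leq 𝔸 (∇ x) (∇ y)

record CompleteMAlg (ℓ : Level) : Set (suc ℓ) where
  field
    malg     : MAlg ℓ
  open MAlg malg public
  field
    complete : Complete 𝔸

record CAlg (ℓ : Level) : Set (suc ℓ) where
  field
    𝔸      : BooleanAlgebra ℓ ℓ
  open BooleanAlgebra 𝔸
  field
    _⊳_      : Carrier → Carrier → Carrier
    ⊳-cong   : ∀ {a a′ b b′} → a ≈ a′ → b ≈ b′ → (a ⊳ b) ≈ (a′ ⊳ b′)
    ⊳-⊤      : ∀ a → (a ⊳ ⊤) ≈ ⊤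
    ⊳-∧      : ∀ a b c → (a ⊳ (b ∧ c)) ≈ ((a ⊳ b) ∧ (a ⊳ c))

record CompleteCAlg (ℓ : Level) : Set (suc ℓ) where
  field
    calg     : CAlg ℓ
  open CAlg calg public
  field
    complete : Complete 𝔸
    ⊳-meets  : ∀ a → MeetPres 𝔸 𝔸 (a ⊳_)

record HetMAlg (ℓ : Level) : Set (suc ℓ) where
  field
    𝔸 𝔹  : BooleanAlgebra ℓ ℓ
  private
    module A = BooleanAlgebra 𝔸
    module B = BooleanAlgebra 𝔹
  field
    [∋]  : A.Carrier → B.Carrier
    ⟨∌⟩  : A.Carrier → B.Carrier
    ⟨ν⟩  : B.Carrier → A.Carrier
    [νᶜ] : B.Carrier → A.Carrier

module _ {ℓ : Level} (H : HetMAlg ℓ) where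
  open HetMAlg H

  IsHetMAlg : Set ℓ
  IsHetMAlg = FinJoinPres 𝔹 𝔸 ⟨ν⟩ × FinMeetPres 𝔹 𝔸 [νᶜ]
            × FinMeetPres 𝔸 𝔹 [∋] × FinJoinPres 𝔸 𝔹 ⟨∌⟩

  IsSupported : Set ℓ
  IsSupported = ∀ a → BooleanAlgebra._≈_ 𝔸 (⟨ν⟩ ([∋] a)) ([νᶜ] (⟨∌⟩ a))

  IsCompleteHetMAlg : Set (suc ℓ)
  IsCompleteHetMAlg = IsHetMAlg × Complete 𝔸 × Complete 𝔹
            × JoinPres 𝔹 𝔸 ⟨ν⟩ × MeetPres 𝔹 𝔸 [νᶜ]
            × MeetPres 𝔸 𝔹 [∋] × JoinPres 𝔸 𝔹 ⟨∌⟩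

record HetCAlg (ℓ : Level) : Set (suc ℓ) where
  field
    𝔸 𝔹  : BooleanAlgebra ℓ ℓ
  private
    module A = BooleanAlgebra 𝔸
    module B = BooleanAlgebra 𝔹
  field
    [∋]  : A.Carrier → B.Carrier
    [∌⟩  : A.Carrier → B.Carrier
    _▷_  : B.Carrier → A.Carrier → A.Carrier

module _ {ℓ : Level} (H : HetCAlg ℓ) where
  open HetCAlg H

  IsHetCAlg : Set ℓ
  IsHetCAlg = FinMeetPres 𝔸 𝔹 [∋] × FinJoinRev 𝔸 𝔹 [∌⟩
            × (∀ a → FinJoinRev 𝔹 𝔸 (_▷ a)) × (∀ b → FinMeetPres 𝔸 𝔸 (b ▷_))

  IsCompleteHetCAlg : Set (suc ℓ)
  IsCompleteHetCAlg = IsHetCAlg × Complete 𝔸 × Complete 𝔹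
            × MeetPres 𝔸 𝔹 [∋] × JoinRev 𝔸 𝔹 [∌⟩
            × (∀ a → JoinRev 𝔹 𝔸 (_▷ a)) × (∀ b → MeetPres 𝔸 𝔸 (b ▷_))

-- The powerset algebra P(A): subsets of (the quotient of) the carrier,
-- represented as ≈-closed Bool-valued predicates, ordered pointwise.

dec-≡ : ∀ {ℓ} {P Q : Set ℓ} (p : Dec P) (q : Dec Q) →
        (P → Q) → (Q → P) → does p ≡ does q
dec-≡ (yes _) (yes _) _ _ = refl
dec-≡ (yes x) (no ¬y) f g with ¬y (f x)
... | ()
dec-≡ (no ¬x) (yes y) f g with ¬x (g y)
... | ()
dec-≡ (no _) (no _) _ _ = refl

module Pow {ℓ : Level} (𝔸 : BooleanAlgebra ℓ ℓ) where
  open BooleanAlgebra 𝔸 using (Carrier; _≈_)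
  module A = BooleanAlgebra 𝔸

  Subset : Set ℓ
  Subset = Σ (Carrier → Bool) (λ P → ∀ {x y} → x ≈ y → P x ≡ P y)

  _∈_ : Carrier → Subset → Bool
  x ∈ P = proj₁ P x

  _≈ₚ_ : Subset → Subset → Set ℓ
  P ≈ₚ Q = ∀ x → proj₁ P x ≡ proj₁ Q x

  _∪_ : Subset → Subset → Subset
  (P , p) ∪ (Q , q) = (λ x → P x 𝔹.∨ Q x) , λ e → cong₂ 𝔹._∨_ (p e) (q e)

  _∩_ : Subset → Subset → Subset
  (P , p) ∩ (Q , q) = (λ x → P x 𝔹.∧ Q x) , λ e → cong₂ 𝔹._∧_ (p e) (q e)

  ∁ : Subset → Subset
  ∁ (P , p) = (λ x → 𝔹.not (P x)) , λ e → cong 𝔹.not (p e)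

  full : Subset
  full = (λ _ → true) , λ _ → refl

  empty : Subset
  empty = (λ _ → false) , λ _ → refl

  isBA : IsBooleanAlgebra _≈ₚ_ _∪_ _∩_ ∁ full empty
  isBA = record
    { isDistributiveLattice = record
      { isLattice = record
        { isEquivalence = record
          { refl = λ _ → refl ; sym = λ e x → sym (e x)
          ; trans = λ e f x → trans (e x) (f x) }
        ; ∨-comm = λ P Q x → 𝔹P.∨-comm (proj₁ P x) (proj₁ Q x)
        ; ∨-assoc = λ P Q R x → 𝔹P.∨-assoc (proj₁ P x) (proj₁ Q x) (proj₁ R x)
        ; ∨-cong = λ e f x → cong₂ 𝔹._∨_ (e x) (f x)
        ; ∧-comm = λ P Q x → 𝔹P.∧-comm (proj₁ P x) (proj₁ Q x)
        ; ∧-assoc = λ P Q R x → 𝔹P.∧-assoc (proj₁ P x) (proj₁ Q x) (proj₁ R x)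
        ; ∧-cong = λ e f x → cong₂ 𝔹._∧_ (e x) (f x)
        ; absorptive = (λ P Q x → 𝔹P.∨-abs-∧ (proj₁ P x) (proj₁ Q x))
                     , (λ P Q x → 𝔹P.∧-abs-∨ (proj₁ P x) (proj₁ Q x))
        }
      ; ∨-distrib-∧ = (λ P Q R x → proj₁ 𝔹P.∨-distrib-∧ (proj₁ P x) (proj₁ Q x) (proj₁ R x))
                    , (λ P Q R x → proj₂ 𝔹P.∨-distrib-∧ (proj₁ P x) (proj₁ Q x) (proj₁ R x))
      ; ∧-distrib-∨ = (λ P Q R x → proj₁ 𝔹P.∧-distrib-∨ (proj₁ P x) (proj₁ Q x) (proj₁ R x))
                    , (λ P Q R x → proj₂ 𝔹P.∧-distrib-∨ (proj₁ P x) (proj₁ Q x) (proj₁ R x))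
      }
    ; ∨-complement = (λ P x → proj₁ 𝔹P.∨-inverse (proj₁ P x))
                   , (λ P x → proj₂ 𝔹P.∨-inverse (proj₁ P x))
    ; ∧-complement = (λ P x → proj₁ 𝔹P.∧-inverse (proj₁ P x))
                   , (λ P x → proj₂ 𝔹P.∧-inverse (proj₁ P x))
    ; ¬-cong = λ e x → cong 𝔹.not (e x)
    }

  𝒫 : BooleanAlgebra ℓ ℓ
  𝒫 = record { isBooleanAlgebra = isBA }

  open SetoidReasoning A.setoid

  ≤-respˡ : ∀ {x x′ y} → x ≈ x′ → Leq 𝔸 x y → Leq 𝔸 x′ y
  ≤-respˡ {x} {x′} {y} e le = begin
    x′ A.∧ y ≈⟨ A.∧-cong (A.sym e) A.refl ⟩
    x A.∧ y  ≈⟨ le ⟩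
    x      ≈⟨ e ⟩
    x′     ∎

  ≤-respʳ : ∀ {x y y′} → y ≈ y′ → Leq 𝔸 x y → Leq 𝔸 x y′
  ≤-respʳ {x} {y} {y′} e le = begin
    x A.∧ y′ ≈⟨ A.∧-cong A.refl (A.sym e) ⟩
    x A.∧ y  ≈⟨ le ⟩
    x      ∎

  downset : LEM ℓ → Carrier → Subset
  downset lem a = (λ b → does (lem (Leq 𝔸 b a))) ,
    λ e → dec-≡ (lem _) (lem _) (≤-respˡ e) (≤-respˡ (A.sym e))

  upset : LEM ℓ → Carrier → Subset
  upset lem a = (λ b → does (lem (Leq 𝔸 a b))) ,
    λ e → dec-≡ (lem _) (lem _) (≤-respʳ e) (≤-respʳ (A.sym e))

  nonUpset : LEM ℓ → Carrier → Subset
  nonUpset lem a = (λ b → does (lem (¬ Leq 𝔸 a b))) ,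
    λ e → dec-≡ (lem _) (lem _) (λ n l → n (≤-respʳ (A.sym e) l))
                                (λ n l → n (≤-respʳ e l))

bulletM : ∀ {ℓ} → LEM ℓ → CompleteMAlg ℓ → HetMAlg ℓ
bulletM {ℓ} lem C = record
  { 𝔸 = 𝔸
  ; 𝔹 = 𝒫
  ; [∋] = downset lem
  ; ⟨∌⟩ = nonUpset lem
  ; ⟨ν⟩ = λ B → ⋁ {I = Σ Carrier (λ b → (b ∈ B) ≡ true)} (λ p → ∇ (proj₁ p))
  ; [νᶜ] = λ B → ⋀ {I = Σ Carrier (λ b → (b ∈ B) ≡ false)} (λ p → ∇ (proj₁ p))
  }
  where
    open CompleteMAlg C
    open BooleanAlgebra 𝔸 using (Carrier)
    open Complete complete
    open Pow 𝔸

bulletC : ∀ {ℓ} → LEM ℓ → CompleteCAlg ℓ → HetCAlg ℓ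
bulletC {ℓ} lem C = record
  { 𝔸 = 𝔸
  ; 𝔹 = 𝒫
  ; [∋] = downset lem
  ; [∌⟩ = upset lem
  ; _▷_ = λ B a → ⋀ {I = Σ Carrier (λ b → (b ∈ B) ≡ true)} (λ p → proj₁ p ⊳ a)
  }
  where
    open CompleteCAlg C
    open BooleanAlgebra 𝔸 using (Carrier)
    open Complete complete
    open Pow 𝔸

-- A map preserving (or reversing) arbitrary joins or meets also does so for the
-- finite ones, which are the bounds of families indexed by the empty and by a
-- two-element set; one-element families give congruence. So only arbitrary
-- bounds need checking. For any g, B ↦ ⋁_{b∈B} g b sends unions to joins and
-- B ↦ ⋀_{b∈B} g b sends them to meets, because a member of a union lies in one
-- of the sets; dually B ↦ ⋀_{b∉B} g b sends intersections to meets. The maps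
-- a ↦ ↓a and a ↦ ↑a turn meets, resp. joins, into intersections by the
-- universal property, and a ↦ {b | a ≰ b} turns joins into unions by excluded
-- middle: if ⋁ aᵢ ≰ b then some aᵢ ≰ b. Finally B ▷ _ is a pointwise meet of
-- the meet-preserving maps b > _, and supportedness holds because, ∇ being
-- monotone, ⋁_{b ≤ a} ∇b and ⋀_{a ≤ b} ∇b both equal ∇a.

module Submission where

open import Level using (Level; Lift; lift)
open import Data.Bool using (Bool; true; false; if_then_else_)
open import Data.Bool.Properties using (∧-conicalʳ; ¬-not; not-¬)
open import Data.Empty.Polymorphic using () renaming (⊥ to 𝟘)
open import Data.Unit.Polymorphic using (tt) renaming (⊤ to 𝟙)
open import Data.Product using (Σ; _×_; _,_; proj₁; proj₂; map₂)
open import Function using (_∘_)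
open import Relation.Nullary using (Dec; does; yes; no; ¬_)
open import Relation.Nullary.Decidable using (dec-true; dec-false; decidable-stable)
open import Relation.Binary.PropositionalEquality as ≡ using (_≡_; refl)
open import Algebra.Lattice.Bundles using (BooleanAlgebra)
import Algebra.Lattice.Properties.BooleanAlgebra as BooleanAlgebraProperties
import Algebra.Lattice.Properties.Lattice as LatticeProperties
import Relation.Binary.Lattice.Bundles as OrderTheoretic
open import Defs

module _ {a} {A : Set a} where

  dec-true⁻¹ : (a? : Dec A) → does a? ≡ true → A
  dec-true⁻¹ (yes a) _ = a
  dec-true⁻¹ (no _) ()

  dec-false⁻¹ : (a? : Dec A) → does a? ≡ false → ¬ A
  dec-false⁻¹ (no ¬a) _ = ¬a
  dec-false⁻¹ (yes _) ()

pair : ∀ {ℓ} {A : Set ℓ} → A → A → Lift ℓ Bool → A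
pair x y (lift b) = if b then x else y

module Order {ℓ : Level} (𝔸 : BooleanAlgebra ℓ ℓ) where
  open BooleanAlgebra 𝔸 public
  open BooleanAlgebraProperties 𝔸 using (∧-identityʳ; ∧-zeroˡ)
  open LatticeProperties lattice using (∧-idem; ∨-∧-orderTheoreticLattice)
  open Pow 𝔸 using (≤-respˡ; ≤-respʳ)
  -- The library orders a lattice by x ≈ x ∧ y, which is Leq read backwards.
  private module N = OrderTheoretic.Lattice ∨-∧-orderTheoreticLattice

  infix 4 _≤_
  _≤_ : Carrier → Carrier → Set ℓ
  _≤_ = Leq 𝔸

  ≤-refl : ∀ {x} → x ≤ x
  ≤-refl = ∧-idem _

  ≤-trans : ∀ {x y z} → x ≤ y → y ≤ z → x ≤ z
  ≤-trans x≤y y≤z = sym (N.trans (sym x≤y) (sym y≤z))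

  ≤-antisym : ∀ {x y} → x ≤ y → y ≤ x → x ≈ y
  ≤-antisym x≤y y≤x = N.antisym (sym x≤y) (sym y≤x)

  ⊥≤ : ∀ {x} → ⊥ ≤ x
  ⊥≤ = ∧-zeroˡ _

  ≤⊤ : ∀ {x} → x ≤ ⊤
  ≤⊤ = ∧-identityʳ _

  lub-unique : ∀ {I : Set ℓ} {f : I → Carrier} {x y} → IsLub 𝔸 f x → IsLub 𝔸 f y → x ≈ y
  lub-unique (ubx , leastx) (uby , leasty) = ≤-antisym (leastx _ uby) (leasty _ ubx)

  glb-unique : ∀ {I : Set ℓ} {f : I → Carrier} {x y} → IsGlb 𝔸 f x → IsGlb 𝔸 f y → x ≈ y
  glb-unique (lbx , greatestx) (lby , greatesty) = ≤-antisym (greatesty _ lbx) (greatestx _ lby)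

  isLub-single : ∀ {x y} → x ≈ y → IsLub 𝔸 (λ (_ : 𝟙 {ℓ}) → y) x
  isLub-single x≈y = (λ _ → ≤-respʳ (sym x≈y) ≤-refl) , λ _ y≤z → ≤-respˡ (sym x≈y) (y≤z tt)

  isGlb-single : ∀ {x y} → x ≈ y → IsGlb 𝔸 (λ (_ : 𝟙 {ℓ}) → y) x
  isGlb-single x≈y = (λ _ → ≤-respʳ x≈y ≤-refl) , λ _ z≤y → ≤-respʳ (sym x≈y) (z≤y tt)

  isLub-∅ : (f : 𝟘 {ℓ} → Carrier) → IsLub 𝔸 f ⊥
  isLub-∅ f = (λ ()) , λ _ _ → ⊥≤

  isGlb-∅ : (f : 𝟘 {ℓ} → Carrier) → IsGlb 𝔸 f ⊤
  isGlb-∅ f = (λ ()) , λ _ _ → ≤⊤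

  isLub-pair : (f : Lift ℓ Bool → Carrier) → IsLub 𝔸 f (f (lift true) ∨ f (lift false))
  isLub-pair f = (λ { (lift true) → sym (N.x≤x∨y _ _) ; (lift false) → sym (N.y≤x∨y _ _) })
               , λ _ ub → sym (N.∨-least (sym (ub (lift true))) (sym (ub (lift false))))

  isGlb-pair : (f : Lift ℓ Bool → Carrier) → IsGlb 𝔸 f (f (lift true) ∧ f (lift false))
  isGlb-pair f = (λ { (lift true) → sym (N.x∧y≤x _ _) ; (lift false) → sym (N.x∧y≤y _ _) })
               , λ _ lb → sym (N.∧-greatest (sym (lb (lift true))) (sym (lb (lift false))))

module _ {ℓ : Level} (𝔸 𝔹 : BooleanAlgebra ℓ ℓ)
         {h : BooleanAlgebra.Carrier 𝔸 → BooleanAlgebra.Carrier 𝔹} where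
  private
    module A = Order 𝔸
    module B = Order 𝔹

  JoinPres⇒FinJoinPres : JoinPres 𝔸 𝔹 h → FinJoinPres 𝔸 𝔹 h
  JoinPres⇒FinJoinPres pres =
      (λ {_} {y} x≈y →
         B.lub-unique (pres (λ _ → y) _ (A.isLub-single x≈y)) (B.isLub-single B.refl))
    , B.lub-unique (pres {I = 𝟘} (λ ()) _ (A.isLub-∅ _)) (B.isLub-∅ _)
    , λ x y → B.lub-unique (pres (pair x y) _ (A.isLub-pair _)) (B.isLub-pair _)

  MeetPres⇒FinMeetPres : MeetPres 𝔸 𝔹 h → FinMeetPres 𝔸 𝔹 h
  MeetPres⇒FinMeetPres pres =
      (λ {_} {y} x≈y →
         B.glb-unique (pres (λ _ → y) _ (A.isGlb-single x≈y)) (B.isGlb-single B.refl))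
    , B.glb-unique (pres {I = 𝟘} (λ ()) _ (A.isGlb-∅ _)) (B.isGlb-∅ _)
    , λ x y → B.glb-unique (pres (pair x y) _ (A.isGlb-pair _)) (B.isGlb-pair _)

  JoinRev⇒FinJoinRev : JoinRev 𝔸 𝔹 h → FinJoinRev 𝔸 𝔹 h
  JoinRev⇒FinJoinRev rev =
      (λ {_} {y} x≈y →
         B.glb-unique (rev (λ _ → y) _ (A.isLub-single x≈y)) (B.isGlb-single B.refl))
    , B.glb-unique (rev {I = 𝟘} (λ ()) _ (A.isLub-∅ _)) (B.isGlb-∅ _)
    , λ x y → B.glb-unique (rev (pair x y) _ (A.isLub-pair _)) (B.isGlb-pair _)

module CompleteOrder {ℓ : Level} {𝔸 : BooleanAlgebra ℓ ℓ} (complete : Complete 𝔸) where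
  open Order 𝔸
  open Complete complete public

  ⋁-ub : ∀ {I : Set ℓ} (f : I → Carrier) i → f i ≤ ⋁ f
  ⋁-ub f = proj₁ (⋁-lub f)

  ⋁-least : ∀ {I : Set ℓ} (f : I → Carrier) {y} → (∀ i → f i ≤ y) → ⋁ f ≤ y
  ⋁-least f = proj₂ (⋁-lub f) _

  ⋀-lb : ∀ {I : Set ℓ} (f : I → Carrier) i → ⋀ f ≤ f i
  ⋀-lb f = proj₁ (⋀-glb f)

  ⋀-greatest : ∀ {I : Set ℓ} (f : I → Carrier) {y} → (∀ i → y ≤ f i) → y ≤ ⋀ f
  ⋀-greatest f = proj₂ (⋀-glb f) _

  ⋁-mono : ∀ {I J : Set ℓ} {f : I → Carrier} {g : J → Carrier} (r : I → J) →
           (∀ i → f i ≤ g (r i)) → ⋁ f ≤ ⋁ g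
  ⋁-mono {f = f} {g} r f≤g = ⋁-least f λ i → ≤-trans (f≤g i) (⋁-ub g (r i))

  ⋀-mono : ∀ {I J : Set ℓ} {f : I → Carrier} {g : J → Carrier} (r : J → I) →
           (∀ j → f (r j) ≤ g j) → ⋀ f ≤ ⋀ g
  ⋀-mono {f = f} {g} r f≤g = ⋀-greatest g λ j → ≤-trans (⋀-lb f (r j)) (f≤g j)

  ⋀-meetPres : ∀ {𝔻 : BooleanAlgebra ℓ ℓ} {J : Set ℓ}
               (h : J → BooleanAlgebra.Carrier 𝔻 → Carrier) →
               (∀ j → MeetPres 𝔻 𝔸 (h j)) → MeetPres 𝔻 𝔸 (λ x → ⋀ λ j → h j x)
  ⋀-meetPres h pres f x glb =
      (λ i → ⋀-mono (λ j → j) λ j → proj₁ (pres j f x glb) i)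
    , λ y y≤ → ⋀-greatest _ λ j → proj₂ (pres j f x glb) y λ i → ≤-trans (y≤ i) (⋀-lb _ j)

module Powerset {ℓ : Level} (lem : LEM ℓ) (𝔻 : BooleanAlgebra ℓ ℓ) where
  open Order 𝔻 using (_≤_; ≤-trans)
  open Pow 𝔻 public using (Subset; _∈_; 𝒫; downset; upset; nonUpset)
  private module P = Order 𝒫

  infix 4 _⊆_
  _⊆_ : Subset → Subset → Set ℓ
  P ⊆ Q = ∀ b → b ∈ P ≡ true → b ∈ Q ≡ true

  ⊆⇒≤ : ∀ {P Q} → P ⊆ Q → P P.≤ Q
  ⊆⇒≤ {P} P⊆Q b with b ∈ P in b∈P
  ... | false = refl
  ... | true = P⊆Q b b∈P

  ≤⇒⊆ : ∀ {P Q} → P P.≤ Q → P ⊆ Q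
  ≤⇒⊆ {P} P≤Q b b∈P = ∧-conicalʳ (b ∈ P) _ (≡.trans (P≤Q b) b∈P)

  ∉-⊆ : ∀ {P Q} → P ⊆ Q → ∀ b → b ∈ Q ≡ false → b ∈ P ≡ false
  ∉-⊆ {P} P⊆Q b b∉Q with b ∈ P in b∈P
  ... | false = refl
  ... | true = ≡.trans (≡.sym (P⊆Q b b∈P)) b∉Q

  ⊆-isLub : ∀ {I : Set ℓ} (F : I → Subset) X →
            (∀ i → F i ⊆ X) → (∀ Y → (∀ i → F i ⊆ Y) → X ⊆ Y) → IsLub 𝒫 F X
  ⊆-isLub F X ub least =
      (λ i → ⊆⇒≤ {F i} {X} (ub i))
    , λ Y ≤Y → ⊆⇒≤ {X} {Y} (least Y λ i → ≤⇒⊆ {F i} {Y} (≤Y i))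

  ⊆-isGlb : ∀ {I : Set ℓ} (F : I → Subset) X →
            (∀ i → X ⊆ F i) → (∀ Y → (∀ i → Y ⊆ F i) → Y ⊆ X) → IsGlb 𝒫 F X
  ⊆-isGlb F X lb greatest =
      (λ i → ⊆⇒≤ {X} {F i} (lb i))
    , λ Y Y≤ → ⊆⇒≤ {Y} {X} (greatest Y λ i → ≤⇒⊆ {Y} {F i} (Y≤ i))

  isLub⇒⊆ : ∀ {I : Set ℓ} (F : I → Subset) X → IsLub 𝒫 F X → ∀ i → F i ⊆ X
  isLub⇒⊆ F X (ub , _) i = ≤⇒⊆ {F i} {X} (ub i)

  isGlb⇒⊆ : ∀ {I : Set ℓ} (F : I → Subset) X → IsGlb 𝒫 F X → ∀ i → X ⊆ F i
  isGlb⇒⊆ F X (lb , _) i = ≤⇒⊆ {X} {F i} (lb i)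

  ⋃ : {I : Set ℓ} → (I → Subset) → Subset
  ⋃ {I} F = (λ b → does (lem (Σ I λ i → b ∈ F i ≡ true)))
          , λ b≈c → dec-≡ (lem _) (lem _)
                      (map₂ λ {i} → ≡.trans (≡.sym (proj₂ (F i) b≈c)))
                      (map₂ λ {i} → ≡.trans (proj₂ (F i) b≈c))

  ⋂ : {I : Set ℓ} → (I → Subset) → Subset
  ⋂ {I} F = (λ b → does (lem (∀ i → b ∈ F i ≡ true)))
          , λ b≈c → dec-≡ (lem _) (lem _)
                      (λ b∈F i → ≡.trans (≡.sym (proj₂ (F i) b≈c)) (b∈F i))
                      (λ c∈F i → ≡.trans (proj₂ (F i) b≈c) (c∈F i))

  ⋃-isLub : {I : Set ℓ} (F : I → Subset) → IsLub 𝒫 F (⋃ F)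
  ⋃-isLub F = ⊆-isLub F (⋃ F)
    (λ i b b∈Fi → dec-true (lem _) (i , b∈Fi))
    (λ Y ⊆Y b b∈⋃F → let (i , b∈Fi) = dec-true⁻¹ (lem _) b∈⋃F in ⊆Y i b b∈Fi)

  ⋂-isGlb : {I : Set ℓ} (F : I → Subset) → IsGlb 𝒫 F (⋂ F)
  ⋂-isGlb F = ⊆-isGlb F (⋂ F)
    (λ i b b∈⋂F → dec-true⁻¹ (lem _) b∈⋂F i)
    (λ Y Y⊆ b b∈Y → dec-true (lem _) λ i → Y⊆ i b b∈Y)

  𝒫-complete : Complete 𝒫
  𝒫-complete = record { ⋁ = ⋃ ; ⋁-lub = ⋃-isLub ; ⋀ = ⋂ ; ⋀-glb = ⋂-isGlb }

  ∈-lub : ∀ {I : Set ℓ} (F : I → Subset) X → IsLub 𝒫 F X →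
          ∀ {b} → b ∈ X ≡ true → Σ I λ i → b ∈ F i ≡ true
  ∈-lub F X (_ , least) b∈X =
    dec-true⁻¹ (lem _) (≤⇒⊆ {X} {⋃ F} (least (⋃ F) (proj₁ (⋃-isLub F))) _ b∈X)

  ∉-glb : ∀ {I : Set ℓ} (F : I → Subset) X → IsGlb 𝒫 F X →
          ∀ {b} → b ∈ X ≡ false → Σ I λ i → b ∈ F i ≡ false
  ∉-glb F X (_ , greatest) b∉X = decidable-stable (lem _) λ b∈all →
    not-¬ b∉X (≤⇒⊆ {⋂ F} {X} (greatest (⋂ F) (proj₁ (⋂-isGlb F))) _
                  (dec-true (lem _) λ i → ¬-not λ b∉Fi → b∈all (i , b∉Fi)))

  downset-meetPres : MeetPres 𝔻 𝒫 (downset lem)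
  downset-meetPres f x (lb , greatest) = ⊆-isGlb (downset lem ∘ f) (downset lem x)
    (λ i b b≤x → dec-true (lem _) (≤-trans (dec-true⁻¹ (lem _) b≤x) (lb i)))
    (λ Y Y⊆ b b∈Y → dec-true (lem _) (greatest b λ i → dec-true⁻¹ (lem _) (Y⊆ i b b∈Y)))

  upset-joinRev : JoinRev 𝔻 𝒫 (upset lem)
  upset-joinRev f x (ub , least) = ⊆-isGlb (upset lem ∘ f) (upset lem x)
    (λ i b x≤b → dec-true (lem _) (≤-trans (ub i) (dec-true⁻¹ (lem _) x≤b)))
    (λ Y Y⊆ b b∈Y → dec-true (lem _) (least b λ i → dec-true⁻¹ (lem _) (Y⊆ i b b∈Y)))

  nonUpset-joinPres : JoinPres 𝔻 𝒫 (nonUpset lem)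
  nonUpset-joinPres {I} f x (ub , least) = ⊆-isLub (nonUpset lem ∘ f) (nonUpset lem x)
    (λ i b fi≰b → dec-true (lem _) λ x≤b → dec-true⁻¹ (lem _) fi≰b (≤-trans (ub i) x≤b))
    (λ Y ⊆Y b x≰b → let (i , fi≰b) = some-≰ b (dec-true⁻¹ (lem _) x≰b) in
                    ⊆Y i b (dec-true (lem _) fi≰b))
    where
    some-≰ : ∀ b → ¬ x ≤ b → Σ I λ i → ¬ f i ≤ b
    some-≰ b x≰b = decidable-stable (lem _) λ none →
      x≰b (least b λ i → decidable-stable (lem _) λ fi≰b → none (i , fi≰b))

module Image {ℓ : Level} (lem : LEM ℓ) (𝔻 : BooleanAlgebra ℓ ℓ)
             {𝔸 : BooleanAlgebra ℓ ℓ} (complete : Complete 𝔸) where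
  open Powerset lem 𝔻
  open Order 𝔸
  open CompleteOrder complete
  private module D = Order 𝔻

  ⋁∈ : (D.Carrier → Carrier) → Subset → Carrier
  ⋁∈ g B = ⋁ {I = Σ D.Carrier λ b → b ∈ B ≡ true} (g ∘ proj₁)

  ⋀∈ : (D.Carrier → Carrier) → Subset → Carrier
  ⋀∈ g B = ⋀ {I = Σ D.Carrier λ b → b ∈ B ≡ true} (g ∘ proj₁)

  ⋀∉ : (D.Carrier → Carrier) → Subset → Carrier
  ⋀∉ g B = ⋀ {I = Σ D.Carrier λ b → b ∈ B ≡ false} (g ∘ proj₁)

  module _ (g : D.Carrier → Carrier) where

    ⋁∈-mono : ∀ {P Q} → P ⊆ Q → ⋁∈ g P ≤ ⋁∈ g Q
    ⋁∈-mono P⊆Q = ⋁-mono (λ (b , b∈P) → b , P⊆Q b b∈P) λ _ → ≤-refl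

    ⋀∈-anti : ∀ {P Q} → P ⊆ Q → ⋀∈ g Q ≤ ⋀∈ g P
    ⋀∈-anti P⊆Q = ⋀-mono (λ (b , b∈P) → b , P⊆Q b b∈P) λ _ → ≤-refl

    ⋀∉-mono : ∀ {P Q} → P ⊆ Q → ⋀∉ g P ≤ ⋀∉ g Q
    ⋀∉-mono {P} {Q} P⊆Q = ⋀-mono (λ (b , b∉Q) → b , ∉-⊆ {P} {Q} P⊆Q b b∉Q) λ _ → ≤-refl

    ⋁∈-joinPres : JoinPres 𝒫 𝔸 (⋁∈ g)
    ⋁∈-joinPres F X lub =
        (λ i → ⋁∈-mono {F i} {X} (isLub⇒⊆ F X lub i))
      , λ y ≤y → ⋁-least _ λ (b , b∈X) → let (i , b∈Fi) = ∈-lub F X lub b∈X in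
                                          ≤-trans (⋁-ub _ (b , b∈Fi)) (≤y i)

    ⋀∈-joinRev : JoinRev 𝒫 𝔸 (⋀∈ g)
    ⋀∈-joinRev F X lub =
        (λ i → ⋀∈-anti {F i} {X} (isLub⇒⊆ F X lub i))
      , λ y y≤ → ⋀-greatest _ λ (b , b∈X) → let (i , b∈Fi) = ∈-lub F X lub b∈X in
                                             ≤-trans (y≤ i) (⋀-lb _ (b , b∈Fi))

    ⋀∉-meetPres : MeetPres 𝒫 𝔸 (⋀∉ g)
    ⋀∉-meetPres F X glb =
        (λ i → ⋀∉-mono {X} {F i} (isGlb⇒⊆ F X glb i))
      , λ y y≤ → ⋀-greatest _ λ (b , b∉X) → let (i , b∉Fi) = ∉-glb F X glb b∉X in
                                             ≤-trans (y≤ i) (⋀-lb _ (b , b∉Fi))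

  module _ {g : D.Carrier → Carrier} (g-mono : ∀ {x y} → x D.≤ y → g x ≤ g y) where

    ⋁∈-downset : ∀ a → ⋁∈ g (downset lem a) ≈ g a
    ⋁∈-downset a = ≤-antisym
      (⋁-least _ λ (b , b≤a) → g-mono (dec-true⁻¹ (lem _) b≤a))
      (⋁-ub _ (a , dec-true (lem _) D.≤-refl))

    ⋀∉-nonUpset : ∀ a → ⋀∉ g (nonUpset lem a) ≈ g a
    ⋀∉-nonUpset a = ≤-antisym
      (⋀-lb _ (a , dec-false (lem _) λ a≰a → a≰a D.≤-refl))
      (⋀-greatest _ λ (b , a≤b) → g-mono (decidable-stable (lem _) (dec-false⁻¹ (lem _) a≤b)))

module _ {ℓ : Level} (H : HetMAlg ℓ) where
  open HetMAlg H

  mkIsCompleteHetMAlg : Complete 𝔸 → Complete 𝔹 →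
                        JoinPres 𝔹 𝔸 ⟨ν⟩ → MeetPres 𝔹 𝔸 [νᶜ] →
                        MeetPres 𝔸 𝔹 [∋] → JoinPres 𝔸 𝔹 ⟨∌⟩ → IsCompleteHetMAlg H
  mkIsCompleteHetMAlg 𝔸-complete 𝔹-complete ν ν̃ ∋ ∌ =
      ( JoinPres⇒FinJoinPres 𝔹 𝔸 ν , MeetPres⇒FinMeetPres 𝔹 𝔸 ν̃
      , MeetPres⇒FinMeetPres 𝔸 𝔹 ∋ , JoinPres⇒FinJoinPres 𝔸 𝔹 ∌ )
    , 𝔸-complete , 𝔹-complete , ν , ν̃ , ∋ , ∌

module _ {ℓ : Level} (H : HetCAlg ℓ) where
  open HetCAlg H

  mkIsCompleteHetCAlg : Complete 𝔸 → Complete 𝔹 →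
                        MeetPres 𝔸 𝔹 [∋] → JoinRev 𝔸 𝔹 [∌⟩ →
                        (∀ a → JoinRev 𝔹 𝔸 (_▷ a)) → (∀ b → MeetPres 𝔸 𝔸 (b ▷_)) →
                        IsCompleteHetCAlg H
  mkIsCompleteHetCAlg 𝔸-complete 𝔹-complete ∋ ∌ ▷ˡ ▷ʳ =
      ( MeetPres⇒FinMeetPres 𝔸 𝔹 ∋ , JoinRev⇒FinJoinRev 𝔸 𝔹 ∌
      , (λ a → JoinRev⇒FinJoinRev 𝔹 𝔸 (▷ˡ a)) , (λ b → MeetPres⇒FinMeetPres 𝔸 𝔸 (▷ʳ b)) )
    , 𝔸-complete , 𝔹-complete , ∋ , ∌ , ▷ˡ , ▷ʳ

module _ {ℓ : Level} (lem : LEM ℓ) (C : CompleteMAlg ℓ) where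
  open CompleteMAlg C
  open BooleanAlgebra 𝔸 using (sym; trans)
  open Powerset lem 𝔸
  open Image lem 𝔸 complete

  bulletM-isComplete : IsCompleteHetMAlg (bulletM lem C)
  bulletM-isComplete = mkIsCompleteHetMAlg (bulletM lem C) complete 𝒫-complete
    (⋁∈-joinPres ∇) (⋀∉-meetPres ∇) downset-meetPres nonUpset-joinPres

  bulletM-isSupported : IsSupported (bulletM lem C)
  bulletM-isSupported a = trans (⋁∈-downset ∇-mono a) (sym (⋀∉-nonUpset ∇-mono a))

module _ {ℓ : Level} (lem : LEM ℓ) (C : CompleteCAlg ℓ) where
  open CompleteCAlg C
  open CompleteOrder complete using (⋀-meetPres)
  open Powerset lem 𝔸
  open Image lem 𝔸 complete

  bulletC-isComplete : IsCompleteHetCAlg (bulletC lem C)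
  bulletC-isComplete = mkIsCompleteHetCAlg (bulletC lem C) complete 𝒫-complete
    downset-meetPres upset-joinRev
    (λ a → ⋀∈-joinRev (_⊳ a))
    (λ B → ⋀-meetPres {𝔻 = 𝔸} (λ (b , _) → b ⊳_) λ (b , _) → ⊳-meets b)

mainTheorem5 : ∀ {ℓ} (lem : LEM ℓ) →
    (∀ (C : CompleteMAlg ℓ) →
    IsCompleteHetMAlg (bulletM lem C) × IsSupported (bulletM lem C))
    × (∀ (C : CompleteCAlg ℓ) → IsCompleteHetCAlg (bulletC lem C))
mainTheorem5 lem = (λ C → bulletM-isComplete lem C , bulletM-isSupported lem C)
                 , bulletC-isComplete lem
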